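{- Suppose some algorithm maintains a $\Delta$-orientation for a sequence of $t$ edge updates, starting from the empty graph, while performing $f$ edge flips. Then for any $r\ge0$ and any $\Delta'\ge 2\Delta$, the $\Delta'$-flipping game on this update sequence interleaved with any $r$ reset operations performs at most $(t+f)\frac{\Delta'+1}{\Delta'+1-2\Delta}$ edge flips.
   Context: A $\Delta$-orientation is an orientation of all edges with every outdegree at most $\Delta$. The $\Delta'$-flipping game maintains an orientation of the current graph: inserted edges are oriented arbitrarily, deleted edges are removed, and a reset operation at a vertex $v$ (applied at an arbitrary vertex at an arbitrary time) flips all outgoing edges of $v$ to become incoming if $v$ has more than $\Delta'$ outgoing edges, and does nothing otherwise. -}

module Defs where

open import Data.Nat using (ℕ; zero; suc; _+_; _<ᵇ_)
open import Data.Bool using (Bool; true; false; _∧_; _∨_; not; if_then_else_)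
open import Data.Fin using (Fin; zero; suc; _≟_)
open import Data.List using (List; []; _∷_)
open import Relation.Nullary using (¬_; yes; no)
open import Relation.Binary.PropositionalEquality using (_≡_)

-- Vertices of the graph are Fin n.  A (partial) orientation is a relation
-- O u v = true meaning "there is an edge oriented u → v".
Orientation : ℕ → Set
Orientation n = Fin n → Fin n → Bool

-- An undirected graph as a symmetric Bool-valued edge relation.
Graph : ℕ → Set
Graph n = Fin n → Fin n → Bool

emptyOr : ∀ {n} → Orientation n
emptyOr _ _ = false

emptyGraph : ∀ {n} → Graph n
emptyGraph _ _ = false

graphOf : ∀ {n} → Orientation n → Graph n
graphOf O u v = O u v ∨ O v u

sumF : ∀ {n} → (Fin n → ℕ) → ℕ
sumF {zero} f = 0
sumF {suc n} f = f zero + sumF (λ i → f (suc i))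

countF : ∀ {n} → (Fin n → Bool) → ℕ
countF p = sumF (λ i → if p i then 1 else 0)

outdeg : ∀ {n} → Orientation n → Fin n → ℕ
outdeg O w = countF (O w)

IsBounded : ∀ {n} → ℕ → Orientation n → Set
IsBounded Δ O = ∀ w → outdeg O w Data.Nat.≤ Δ

Orients : ∀ {n} → Orientation n → Graph n → Set
Orients O G = (∀ u v → graphOf O u v ≡ G u v) × (∀ u v → O u v ≡ true → O v u ≡ false)
  where open import Data.Product using (_×_)

-- edge updates (edges are undirected; ins u v and ins v u denote the same edge)
data Update (n : ℕ) : Set where
  ins : Fin n → Fin n → Update n
  del : Fin n → Fin n → Update n

eqᵇ : ∀ {n} → Fin n → Fin n → Bool
eqᵇ a b with a ≟ b
... | yes _ = true
... | no _ = false

samePair : ∀ {n} → Fin n → Fin n → Fin n → Fin n → Bool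
samePair u v x y = (eqᵇ x u ∧ eqᵇ y v) ∨ (eqᵇ x v ∧ eqᵇ y u)

applyU : ∀ {n} → Graph n → Update n → Graph n
applyU G (ins u v) x y = samePair u v x y ∨ G x y
applyU G (del u v) x y = if samePair u v x y then false else G x y

ValidUpdate : ∀ {n} → Graph n → Update n → Set
ValidUpdate G (ins u v) = (¬ u ≡ v) × (G u v ≡ false)
  where open import Data.Product using (_×_)
ValidUpdate G (del u v) = G u v ≡ true

flips : ∀ {n} → Orientation n → Orientation n → ℕ
flips O O' = sumF (λ u → countF (λ v → O u v ∧ O' v u))

-- After each update the algorithm holds a Δ-orientation of the current graph;
-- the flips charged for a step are the edges present before and after the step
-- whose orientation changed (a lower bound on the flips the algorithm performs).
data AlgRun {n : ℕ} (Δ : ℕ) : Orientation n → List (Update n) → ℕ → Set where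
  done : ∀ {O} → AlgRun Δ O [] 0
  step : ∀ {O O' us f} (u : Update n) →
         ValidUpdate (graphOf O) u →
         Orients O' (applyU (graphOf O) u) →
         IsBounded Δ O' →
         AlgRun Δ O' us f →
         AlgRun Δ O (u ∷ us) (flips O O' + f)

data GameOp (n : ℕ) : Set where
  -- an edge update; the Bool is the (arbitrary) orientation of an inserted
  -- edge ins u v : true means u → v, false means v → u (ignored for deletions)
  upd   : Update n → Bool → GameOp n
  reset : Fin n → GameOp n

updatesOf : ∀ {n} → List (GameOp n) → List (Update n)
updatesOf [] = []
updatesOf (upd u _ ∷ ops) = u ∷ updatesOf ops
updatesOf (reset _ ∷ ops) = updatesOf ops

resetCount : ∀ {n} → List (GameOp n) → ℕ
resetCount [] = 0
resetCount (upd _ _ ∷ ops) = resetCount ops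
resetCount (reset _ ∷ ops) = suc (resetCount ops)

applyOp : ∀ {n} → Orientation n → Update n → Bool → Orientation n
applyOp O (ins u v) b x y =
  if eqᵇ x u ∧ eqᵇ y v then b
  else if eqᵇ x v ∧ eqᵇ y u then not b
  else O x y
applyOp O (del u v) b x y = if samePair u v x y then false else O x y

-- reset at w: flip all out-edges of w to in-edges
flipOut : ∀ {n} → Orientation n → Fin n → Orientation n
flipOut O w x y =
  if eqᵇ x w then false
  else if eqᵇ y w then (O x y ∨ O w x)
  else O x y

gameFlips : ∀ {n} → ℕ → Orientation n → List (GameOp n) → ℕ
gameFlips Δ' O [] = 0
gameFlips Δ' O (upd u b ∷ ops) = gameFlips Δ' (applyOp O u b) ops
gameFlips Δ' O (reset w ∷ ops) =
  if Δ' <ᵇ outdeg O w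
  then outdeg O w + gameFlips Δ' (flipOut O w) ops
  else gameFlips Δ' O ops

module Submission where

-- The game runs alongside the algorithm.  Their orientations Og and Oa always
-- orient the same graph, and the potential Φ = flips Og Oa counts the edges on
-- which they disagree.  With c = Δ'+1-2Δ and D = Δ'+1 we show by induction
-- over the operation list that  (game flips) * c ≤ (updates + algorithm flips + Φ) * D.
--   * An update raises Φ by at most 1 plus the number of flips the algorithm
--     makes (the new edge, and a triangle inequality for disagreements).
--   * A reset at w flips d = outdeg Og w > Δ' edges and, since at most Δ of
--     them agree with Oa, Φ' + d ≤ Φ + 2Δ; hence d * c + Φ' * D ≤ Φ * D, i.e.
--     the reset is paid for by the drop of the potential.

open import Defs
open import Data.Nat using (ℕ; _+_; _*_; _∸_; _≤_; suc; zero; z≤n; s≤s; _<ᵇ_)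
open import Data.Nat.Properties
  using (≤-refl; ≤-trans; ≤-reflexive; +-mono-≤; +-monoʳ-≤; *-monoˡ-≤; *-monoʳ-≤;
         +-cancelʳ-≤; +-identityʳ; *-distribʳ-+; m∸n+n≡m; n≤1+n; m≤m+n; <ᵇ⇒<; module ≤-Reasoning)
open import Data.Bool using (Bool; true; false; _∧_; _∨_; not; if_then_else_; T)
open import Data.Bool.Properties using (∧-comm; ∨-comm; ∨-identityʳ; ∨-inverseˡ; ∨-inverseʳ)
open import Data.Fin using (Fin; zero; suc; _≟_)
open import Data.List using (List; length; []; _∷_)
open import Data.Product using (_,_; proj₁; proj₂)
open import Data.Empty using (⊥; ⊥-elim)
open import Data.Unit using (tt)
open import Relation.Nullary using (yes; no)
open import Relation.Binary.PropositionalEquality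
open import Data.Nat.Tactic.RingSolver using (solve-∀)

⟦_⟧ : Bool → ℕ
⟦ b ⟧ = if b then 1 else 0

sumF-cong : ∀ {n} {f g : Fin n → ℕ} → (∀ i → f i ≡ g i) → sumF f ≡ sumF g
sumF-cong {zero} eq = refl
sumF-cong {suc n} eq = cong₂ _+_ (eq zero) (sumF-cong (λ i → eq (suc i)))

sumF-mono : ∀ {n} {f g : Fin n → ℕ} → (∀ i → f i ≤ g i) → sumF f ≤ sumF g
sumF-mono {zero} le = z≤n
sumF-mono {suc n} le = +-mono-≤ (le zero) (sumF-mono (λ i → le (suc i)))

sumF-zero : ∀ {n} → sumF {n} (λ _ → 0) ≡ 0
sumF-zero {zero} = refl
sumF-zero {suc n} = sumF-zero {n}

sumF-+ : ∀ {n} (f g : Fin n → ℕ) → sumF (λ i → f i + g i) ≡ sumF f + sumF g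
sumF-+ {zero} f g = refl
sumF-+ {suc n} f g = begin
    f zero + g zero + sumF (λ i → f (suc i) + g (suc i))
      ≡⟨ cong (f zero + g zero +_) (sumF-+ (λ i → f (suc i)) (λ i → g (suc i))) ⟩
    f zero + g zero + (sumF (λ i → f (suc i)) + sumF (λ i → g (suc i)))
      ≡⟨ interchange (f zero) (g zero) _ _ ⟩
    f zero + sumF (λ i → f (suc i)) + (g zero + sumF (λ i → g (suc i))) ∎
  where
  open ≡-Reasoning
  interchange : ∀ a b c d → a + b + (c + d) ≡ a + c + (b + d)
  interchange = solve-∀

Σ² : ∀ {n} → (Fin n → Fin n → ℕ) → ℕ
Σ² f = sumF (λ x → sumF (f x))

count² : ∀ {n} → (Fin n → Fin n → Bool) → ℕ
count² R = Σ² (λ x y → ⟦ R x y ⟧)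

Σ²-mono : ∀ {n} {f g : Fin n → Fin n → ℕ} → (∀ x y → f x y ≤ g x y) → Σ² f ≤ Σ² g
Σ²-mono le = sumF-mono (λ x → sumF-mono (le x))

Σ²-+ : ∀ {n} (f g : Fin n → Fin n → ℕ) → Σ² (λ x y → f x y + g x y) ≡ Σ² f + Σ² g
Σ²-+ f g = trans (sumF-cong (λ x → sumF-+ (f x) (g x))) (sumF-+ (λ x → sumF (f x)) (λ x → sumF (g x)))

Σ²-zero : ∀ {n} → Σ² {n} (λ _ _ → 0) ≡ 0
Σ²-zero {n} = trans (sumF-cong {n} {λ _ → sumF {n} (λ _ → 0)} (λ _ → sumF-zero {n})) (sumF-zero {n})

eqᵇ-sound : ∀ {n} {x y : Fin n} → eqᵇ x y ≡ true → x ≡ y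
eqᵇ-sound {x = x} {y} eq with x ≟ y
eqᵇ-sound _ | yes x≡y = x≡y
eqᵇ-sound () | no _

eqᵇ-suc : ∀ {n} (x y : Fin n) → eqᵇ (suc x) (suc y) ≡ eqᵇ x y
eqᵇ-suc x y with x ≟ y
... | yes _ = refl
... | no _ = refl

sumF-point : ∀ {n} (w : Fin n) (k : Fin n → ℕ) →
  sumF (λ y → if eqᵇ y w then k y else 0) ≡ k w
sumF-point {suc n} zero k =
  trans (cong (k zero +_) (sumF-zero {n})) (+-identityʳ (k zero))
sumF-point {suc n} (suc w) k =
  trans (sumF-cong (λ i → cong (λ b → if b then k (suc i) else 0) (eqᵇ-suc i w)))
        (sumF-point w (λ i → k (suc i)))

row-count : ∀ {n} (w : Fin n) (R : Fin n → Fin n → Bool) →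
  count² (λ x y → eqᵇ x w ∧ R x y) ≡ countF (R w)
row-count {n} w R = trans (sumF-cong row) (sumF-point w (λ x → countF (R x)))
  where
  row : ∀ x → countF (λ y → eqᵇ x w ∧ R x y) ≡ (if eqᵇ x w then countF (R x) else 0)
  row x with eqᵇ x w
  ... | true = refl
  ... | false = sumF-zero {n}

column-count : ∀ {n} (w : Fin n) (R : Fin n → Fin n → Bool) →
  count² (λ x y → eqᵇ y w ∧ R y x) ≡ countF (R w)
column-count w R = sumF-cong (λ x → trans (sumF-cong (column x)) (sumF-point w (λ y → ⟦ R y x ⟧)))
  where
  column : ∀ x y → ⟦ eqᵇ y w ∧ R y x ⟧ ≡ (if eqᵇ y w then ⟦ R y x ⟧ else 0)
  column x y with eqᵇ y w
  ... | true = refl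
  ... | false = refl

Covers : ∀ {n} → Orientation n → Orientation n → Set
Covers O O' = ∀ x y → O x y ≡ true → graphOf O' x y ≡ true

-- Triangle inequality: if O₁'s edges are edges of O₂, an edge on which O₁ and O₃
-- disagree is one where O₁ disagrees with O₂ or O₂ disagrees with O₃.
flips-triangle : ∀ {n} (O₁ O₂ O₃ : Orientation n) → Covers O₁ O₂ →
  flips O₁ O₃ ≤ flips O₁ O₂ + flips O₂ O₃
flips-triangle O₁ O₂ O₃ cover =
  ≤-trans (Σ²-mono (λ x y → pointwise (O₁ x y) (O₂ x y) (O₂ y x) (O₃ y x) (cover x y)))
          (≤-reflexive (Σ²-+ (λ x y → ⟦ O₁ x y ∧ O₂ y x ⟧) (λ x y → ⟦ O₂ x y ∧ O₃ y x ⟧)))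
  where
  pointwise : ∀ a o₁ o₂ o₃ → (a ≡ true → o₁ ∨ o₂ ≡ true) →
    ⟦ a ∧ o₃ ⟧ ≤ ⟦ a ∧ o₂ ⟧ + ⟦ o₁ ∧ o₃ ⟧
  pointwise false _ _ _ _ = z≤n
  pointwise true _ _ false _ = z≤n
  pointwise true _ true true _ = s≤s z≤n
  pointwise true true false true _ = s≤s z≤n
  pointwise true false false true cover with cover refl
  ... | ()

flips-⊆ : ∀ {n} (G P H O : Orientation n) → (∀ x y → G x y ≡ true → P x y ∨ H x y ≡ true) →
  flips G O ≤ count² P + flips H O
flips-⊆ G P H O sub =
  ≤-trans (Σ²-mono (λ x y → pointwise (G x y) (P x y) (H x y) (O y x) (sub x y)))
          (≤-reflexive (Σ²-+ (λ x y → ⟦ P x y ⟧) (λ x y → ⟦ H x y ∧ O y x ⟧)))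
  where
  pointwise : ∀ g p h o → (g ≡ true → p ∨ h ≡ true) → ⟦ g ∧ o ⟧ ≤ ⟦ p ⟧ + ⟦ h ∧ o ⟧
  pointwise false _ _ _ _ = z≤n
  pointwise true _ _ false _ = z≤n
  pointwise true true _ true _ = s≤s z≤n
  pointwise true false true true _ = s≤s z≤n
  pointwise true false false true sub with sub refl
  ... | ()

SameGraph : ∀ {n} → Orientation n → Orientation n → Set
SameGraph O O' = ∀ x y → graphOf O x y ≡ graphOf O' x y

-- Orientations of simple graphs have no loops (used to keep resets graph-preserving).
Loopfree : ∀ {n} → Orientation n → Set
Loopfree O = ∀ x → O x x ≡ false

orients-loopfree : ∀ {n} {O : Orientation n} {G : Graph n} → Orients O G → Loopfree O
orients-loopfree {O = O} ori x with O x x in Oxx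
... | false = refl
... | true = trans (sym Oxx) (proj₂ ori x x Oxx)

sameGraph-covers : ∀ {n} {O O' : Orientation n} → SameGraph O O' → Covers O O'
sameGraph-covers {O = O} same x y Oxy = trans (sym (same x y)) (cong (_∨ O y x) Oxy)

samePair-sym : ∀ {n} (u v x y : Fin n) → samePair u v x y ≡ samePair u v y x
samePair-sym u v x y =
  trans (∨-comm (eqᵇ x u ∧ eqᵇ y v) _)
        (cong₂ _∨_ (∧-comm (eqᵇ x v) (eqᵇ y u)) (∧-comm (eqᵇ x u) (eqᵇ y v)))

-- Boolean core of inserting the edge {u,v} in some direction: with
-- e₁ = [x=u], e₂ = [y=v], e₃ = [x=v], e₄ = [y=u] (and u ≠ v, so not e₁ ∧ e₃),
-- the pair {x,y} becomes an edge exactly if it is {u,v} or was one before.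
insert-graph : ∀ e₁ e₂ e₃ e₄ b a a' → (e₁ ≡ true → e₃ ≡ true → ⊥) →
  (if e₁ ∧ e₂ then b else if e₃ ∧ e₄ then not b else a) ∨
  (if e₄ ∧ e₃ then b else if e₂ ∧ e₁ then not b else a')
    ≡ ((e₁ ∧ e₂) ∨ (e₃ ∧ e₄)) ∨ (a ∨ a')
insert-graph true _ true _ _ _ _ u≢v = ⊥-elim (u≢v refl refl)
insert-graph true true false true b _ _ _ = ∨-inverseʳ b
insert-graph true true false false b _ _ _ = ∨-inverseʳ b
insert-graph true false false true _ _ _ _ = refl
insert-graph true false false false _ _ _ _ = refl
insert-graph false _ true true b _ _ _ = ∨-inverseˡ b
insert-graph false true true false _ _ _ _ = refl
insert-graph false false true false _ _ _ _ = refl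
insert-graph false true false true _ _ _ _ = refl
insert-graph false true false false _ _ _ _ = refl
insert-graph false false false true _ _ _ _ = refl
insert-graph false false false false _ _ _ _ = refl

applyOp-graph : ∀ {n} (O : Orientation n) {G : Graph n} (u : Update n) (b : Bool) →
  ValidUpdate G u → ∀ x y → graphOf (applyOp O u b) x y ≡ applyU (graphOf O) u x y
applyOp-graph O (ins u v) b (u≢v , _) x y =
  insert-graph (eqᵇ x u) (eqᵇ y v) (eqᵇ x v) (eqᵇ y u) b (O x y) (O y x)
    (λ x≡u x≡v → u≢v (trans (sym (eqᵇ-sound x≡u)) (eqᵇ-sound x≡v)))
applyOp-graph O (del u v) b _ x y rewrite sym (samePair-sym u v x y) with samePair u v x y
... | true = refl
... | false = refl

applyU-cong : ∀ {n} {G H : Graph n} (u : Update n) → (∀ x y → G x y ≡ H x y) →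
  ∀ x y → applyU G u x y ≡ applyU H u x y
applyU-cong (ins u v) G≡H x y = cong (samePair u v x y ∨_) (G≡H x y)
applyU-cong (del u v) G≡H x y = cong (if samePair u v x y then false else_) (G≡H x y)

update-sameGraph : ∀ {n} (Og Oa Oa' : Orientation n) (u : Update n) (b : Bool) →
  SameGraph Og Oa → ValidUpdate (graphOf Oa) u → Orients Oa' (applyU (graphOf Oa) u) →
  SameGraph (applyOp Og u b) Oa'
update-sameGraph Og Oa Oa' u b same valid ori x y = begin
  graphOf (applyOp Og u b) x y  ≡⟨ applyOp-graph Og u b valid x y ⟩
  applyU (graphOf Og) u x y     ≡⟨ applyU-cong u same x y ⟩
  applyU (graphOf Oa) u x y     ≡⟨ sym (proj₁ ori x y) ⟩
  graphOf Oa' x y               ∎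
  where open ≡-Reasoning

insertedPair : ∀ {n} → Update n → Bool → Orientation n
insertedPair (ins u v) b x y = if b then (eqᵇ x u ∧ eqᵇ y v) else (eqᵇ x v ∧ eqᵇ y u)
insertedPair (del _ _) _ _ _ = false

insertedPair-count : ∀ {n} (u : Update n) (b : Bool) → count² (insertedPair u b) ≤ 1
insertedPair-count (ins u v) true =
  ≤-reflexive (trans (row-count u (λ _ y → eqᵇ y v)) (sumF-point v (λ _ → 1)))
insertedPair-count (ins u v) false =
  ≤-reflexive (trans (row-count v (λ _ y → eqᵇ y u)) (sumF-point u (λ _ → 1)))
insertedPair-count {n} (del _ _) _ = ≤-trans (≤-reflexive (Σ²-zero {n})) z≤n

applyOp-⊆ : ∀ {n} (O : Orientation n) (u : Update n) (b : Bool) →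
  ∀ x y → applyOp O u b x y ≡ true → insertedPair u b x y ∨ O x y ≡ true
applyOp-⊆ O (ins u v) b x y = pointwise (eqᵇ x u ∧ eqᵇ y v) (eqᵇ x v ∧ eqᵇ y u) b (O x y)
  where
  pointwise : ∀ p q b a → (if p then b else if q then not b else a) ≡ true →
    (if b then p else q) ∨ a ≡ true
  pointwise true _ true _ _ = refl
  pointwise false true false _ _ = refl
  pointwise false false true _ Oxy = Oxy
  pointwise false false false _ Oxy = Oxy
applyOp-⊆ O (del u v) b x y with samePair u v x y
... | false = λ Oxy → Oxy

update-potential : ∀ {n} (Og Oa Oa' : Orientation n) (u : Update n) (b : Bool) →
  SameGraph Og Oa → flips (applyOp Og u b) Oa' ≤ 1 + (flips Og Oa + flips Oa Oa')
update-potential Og Oa Oa' u b same = begin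
  flips (applyOp Og u b) Oa'                ≤⟨ flips-⊆ _ (insertedPair u b) Og Oa' (applyOp-⊆ Og u b) ⟩
  count² (insertedPair u b) + flips Og Oa'  ≤⟨ +-mono-≤ (insertedPair-count u b) (flips-triangle Og Oa Oa' (sameGraph-covers {O' = Oa} same)) ⟩
  1 + (flips Og Oa + flips Oa Oa')          ∎
  where open ≤-Reasoning

flipOut-graph : ∀ {n} (O : Orientation n) (w : Fin n) → O w w ≡ false →
  ∀ x y → graphOf (flipOut O w) x y ≡ graphOf O x y
flipOut-graph O w Oww x y with x ≟ w | y ≟ w
... | yes refl | yes refl rewrite Oww = refl
... | yes refl | no _ = ∨-comm (O y x) (O x y)
... | no _ | yes refl = ∨-identityʳ _
... | no _ | no _ = refl

reset-sameGraph : ∀ {n} (Og Oa : Orientation n) (w : Fin n) → SameGraph Og Oa → Loopfree Oa →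
  SameGraph (flipOut Og w) Oa
reset-sameGraph Og Oa w same loopfree x y =
  trans (flipOut-graph Og w Ogww x y) (same x y)
  where
  Ogww : Og w w ≡ false
  Ogww with Og w w in eq
  ... | false = refl
  ... | true = trans (cong (λ b → b ∨ b) (sym eq)) (trans (same w w) (cong (λ b → b ∨ b) (loopfree w)))

-- Each out-edge of w in Og either disagrees with Oa (and the reset repairs it)
-- or is an out-edge of w in Oa (and the reset may break it); edges into w may
-- newly disagree only if they are out-edges of w in Oa.
reset-potential : ∀ {n} (Og Oa : Orientation n) (w : Fin n) → Covers Og Oa →
  flips (flipOut Og w) Oa + outdeg Og w ≤ flips Og Oa + (outdeg Oa w + outdeg Oa w)
reset-potential Og Oa w cover = begin
  flips (flipOut Og w) Oa + outdeg Og w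
    ≡⟨ cong (flips (flipOut Og w) Oa +_) (sym (row-count w Og)) ⟩
  flips (flipOut Og w) Oa + count² (λ x y → eqᵇ x w ∧ Og x y)
    ≡⟨ sym (Σ²-+ (λ x y → ⟦ flipOut Og w x y ∧ Oa y x ⟧) (λ x y → ⟦ eqᵇ x w ∧ Og x y ⟧)) ⟩
  Σ² (λ x y → ⟦ flipOut Og w x y ∧ Oa y x ⟧ + ⟦ eqᵇ x w ∧ Og x y ⟧)
    ≤⟨ Σ²-mono pointwise ⟩
  Σ² (λ x y → ⟦ Og x y ∧ Oa y x ⟧ + (⟦ eqᵇ x w ∧ Oa x y ⟧ + ⟦ eqᵇ y w ∧ Oa y x ⟧))
    ≡⟨ trans (Σ²-+ (λ x y → ⟦ Og x y ∧ Oa y x ⟧) _) (cong (flips Og Oa +_) (Σ²-+ row column)) ⟩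
  flips Og Oa + (count² (λ x y → eqᵇ x w ∧ Oa x y) + count² (λ x y → eqᵇ y w ∧ Oa y x))
    ≡⟨ cong₂ (λ p q → flips Og Oa + (p + q)) (row-count w Oa) (column-count w Oa) ⟩
  flips Og Oa + (outdeg Oa w + outdeg Oa w) ∎
  where
  open ≤-Reasoning
  row column : Fin _ → Fin _ → ℕ
  row x y = ⟦ eqᵇ x w ∧ Oa x y ⟧
  column x y = ⟦ eqᵇ y w ∧ Oa y x ⟧
  out-edge : ∀ a o₁ o₂ k → (a ≡ true → o₁ ∨ o₂ ≡ true) → 0 + ⟦ a ⟧ ≤ ⟦ a ∧ o₂ ⟧ + (⟦ o₁ ⟧ + k)
  out-edge false _ _ _ _ = z≤n
  out-edge true _ true _ _ = s≤s z≤n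
  out-edge true true false _ _ = s≤s z≤n
  out-edge true false false _ cover with cover refl
  ... | ()
  in-edge : ∀ a a' o → ⟦ (a ∨ a') ∧ o ⟧ + 0 ≤ ⟦ a ∧ o ⟧ + (0 + ⟦ o ⟧)
  in-edge true _ o = +-monoʳ-≤ ⟦ o ⟧ z≤n
  in-edge false true o = ≤-reflexive (+-identityʳ ⟦ o ⟧)
  in-edge false false _ = z≤n
  pointwise : ∀ x y → ⟦ flipOut Og w x y ∧ Oa y x ⟧ + ⟦ eqᵇ x w ∧ Og x y ⟧
                    ≤ ⟦ Og x y ∧ Oa y x ⟧ + (⟦ eqᵇ x w ∧ Oa x y ⟧ + ⟦ eqᵇ y w ∧ Oa y x ⟧)
  pointwise x y with eqᵇ x w | eqᵇ y w
  ... | true | _ = out-edge (Og x y) (Oa x y) (Oa y x) _ (cover x y)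
  ... | false | true = in-edge (Og x y) (Og w x) (Oa y x)
  ... | false | false = ≤-refl

update-arith : ∀ G L F Φ Φ' fl D → Φ' ≤ 1 + (Φ + fl) →
  G ≤ (L + F + Φ') * D → G ≤ (suc L + (fl + F) + Φ) * D
update-arith G L F Φ Φ' fl D growth bound =
  ≤-trans bound (*-monoˡ-≤ D (≤-trans (+-monoʳ-≤ (L + F) growth) (≤-reflexive (regroup L F Φ fl))))
  where
  regroup : ∀ L F Φ fl → L + F + (1 + (Φ + fl)) ≡ suc L + (fl + F) + Φ
  regroup = solve-∀

reset-pays : ∀ d c k Φ Φ' → c + k ≤ d → Φ' + d ≤ Φ + k → d * c + Φ' * (c + k) ≤ Φ * (c + k)
reset-pays d c k Φ Φ' large drop = +-cancelʳ-≤ (k * (c + k)) _ _ (begin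
    d * c + Φ' * (c + k) + k * (c + k)  ≤⟨ +-monoʳ-≤ (d * c + Φ' * (c + k)) (*-monoʳ-≤ k large) ⟩
    d * c + Φ' * (c + k) + k * d        ≡⟨ collect d c k Φ' ⟩
    (Φ' + d) * (c + k)                  ≤⟨ *-monoˡ-≤ (c + k) drop ⟩
    (Φ + k) * (c + k)                   ≡⟨ *-distribʳ-+ (c + k) Φ k ⟩
    Φ * (c + k) + k * (c + k)           ∎)
  where
  open ≤-Reasoning
  collect : ∀ d c k Φ' → d * c + Φ' * (c + k) + k * d ≡ (Φ' + d) * (c + k)
  collect = solve-∀

reset-arith : ∀ d G c k D B Φ Φ' → c + k ≡ D → D ≤ d → Φ' + d ≤ Φ + k →
  G * c ≤ (B + Φ') * D → (d + G) * c ≤ (B + Φ) * D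
reset-arith d G c k .(c + k) B Φ Φ' refl large drop bound = begin
    (d + G) * c                          ≡⟨ *-distribʳ-+ c d G ⟩
    d * c + G * c                        ≤⟨ +-monoʳ-≤ (d * c) bound ⟩
    d * c + (B + Φ') * (c + k)           ≡⟨ regroup d c k B Φ' ⟩
    B * (c + k) + (d * c + Φ' * (c + k)) ≤⟨ +-monoʳ-≤ (B * (c + k)) (reset-pays d c k Φ Φ' large drop) ⟩
    B * (c + k) + Φ * (c + k)            ≡⟨ sym (*-distribʳ-+ (c + k) B Φ) ⟩
    (B + Φ) * (c + k)                    ∎
  where
  open ≤-Reasoning
  regroup : ∀ d c k B Φ' → d * c + (B + Φ') * (c + k) ≡ B * (c + k) + (d * c + Φ' * (c + k))
  regroup = solve-∀

module Amortisation {n : ℕ} (Δ Δ' : ℕ) (2Δ≤Δ' : 2 * Δ ≤ Δ') where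

  -- The competitive factor is D / c with D = Δ' + 1 and c = D - 2Δ.
  c : ℕ
  c = suc Δ' ∸ 2 * Δ

  c+2Δ≡D : c + 2 * Δ ≡ suc Δ'
  c+2Δ≡D = m∸n+n≡m (≤-trans 2Δ≤Δ' (n≤1+n Δ'))

  game-bound : ∀ (ops : List (GameOp n)) {us f₀} (Og Oa : Orientation n) →
    SameGraph Og Oa → Loopfree Oa → IsBounded Δ Oa → AlgRun Δ Oa us f₀ → updatesOf ops ≡ us →
    gameFlips Δ' Og ops * c ≤ (length us + f₀ + flips Og Oa) * suc Δ'
  game-bound [] _ _ _ _ _ _ _ = z≤n
  game-bound (upd u b ∷ ops) Og Oa same _ _ (step {O' = Oa'} {us = us} {f = f} .u valid ori bounded run) refl =
    update-arith _ (length us) f (flips Og Oa) _ (flips Oa Oa') (suc Δ')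
      (update-potential Og Oa Oa' u b same)
      (game-bound ops (applyOp Og u b) Oa' (update-sameGraph Og Oa Oa' u b same valid ori)
                  (orients-loopfree ori) bounded run refl)
  game-bound (reset w ∷ ops) {us} {f₀} Og Oa same loopfree bounded run eq
    with Δ' <ᵇ outdeg Og w in overfull
  ... | false = game-bound ops Og Oa same loopfree bounded run eq
  ... | true =
    reset-arith (outdeg Og w) _ c (2 * Δ) (suc Δ') (length us + f₀) (flips Og Oa) (flips (flipOut Og w) Oa)
      c+2Δ≡D (<ᵇ⇒< Δ' (outdeg Og w) (subst T (sym overfull) tt)) drop
      (game-bound ops (flipOut Og w) Oa (reset-sameGraph Og Oa w same loopfree) loopfree bounded run eq)
    where
    drop : flips (flipOut Og w) Oa + outdeg Og w ≤ flips Og Oa + 2 * Δ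
    drop = ≤-trans (reset-potential Og Oa w (sameGraph-covers {O' = Oa} same))
      (+-monoʳ-≤ (flips Og Oa) (+-mono-≤ (bounded w) (≤-trans (bounded w) (m≤m+n Δ 0))))

-- The theorem: both start from the empty orientation, where the potential is 0.
lemma10 : (n Δ Δ' t f r : ℕ) (us : List (Update n)) (f₀ : ℕ) →
    length us ≡ t →
    AlgRun Δ emptyOr us f₀ → f₀ ≤ f →
    2 * Δ ≤ Δ' →
    (ops : List (GameOp n)) → updatesOf ops ≡ us → resetCount ops ≡ r →
    gameFlips Δ' emptyOr ops * (suc Δ' ∸ 2 * Δ) ≤ (t + f) * suc Δ'
lemma10 n Δ Δ' t f r us f₀ refl run f₀≤f 2Δ≤Δ' ops eq _ = begin
  gameFlips Δ' emptyOr ops * (suc Δ' ∸ 2 * Δ)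
    ≤⟨ Amortisation.game-bound Δ Δ' 2Δ≤Δ' ops emptyOr emptyOr
         (λ _ _ → refl) (λ _ → refl) empty-bounded run eq ⟩
  (length us + f₀ + flips {n} emptyOr emptyOr) * suc Δ'
    ≡⟨ cong (λ Φ → (length us + f₀ + Φ) * suc Δ') (Σ²-zero {n}) ⟩
  (length us + f₀ + 0) * suc Δ'
    ≡⟨ cong (_* suc Δ') (+-identityʳ (length us + f₀)) ⟩
  (length us + f₀) * suc Δ'
    ≤⟨ *-monoˡ-≤ (suc Δ') (+-monoʳ-≤ (length us) f₀≤f) ⟩
  (length us + f) * suc Δ' ∎
  where
  open ≤-Reasoning
  empty-bounded : IsBounded Δ (emptyOr {n})
  empty-bounded w = subst (_≤ Δ) (sym (sumF-zero {n})) z≤n
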